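{- Let $s,k,d\in\mathbb{Z}_{>0}$ with $\gcd(s,k)=1$ and $s\ge2$, and let $b\ge2$ and $0\le c<b$ be integers. For positive integers $S,K,D$, let $H_D(S,K)$ denote the maximum possible hook length of an $(S,S+K)$-core with $D$-distinct parts. Then $H_{bd+c}(bs,bk)=H_{bd}(bs,bk)$.
   Context: A partition is a weakly decreasing tuple of positive integers $\lambda=(\lambda_1,\dots,\lambda_n)$. The hook length of a cell of its Young diagram is the number of cells weakly to its right in its row plus the number strictly below it in its column. An $(S,T)$-core is a partition with no cell of hook length $S$ or $T$. A partition has $D$-distinct parts if $\lambda_i-\lambda_{i+1}\ge D$ for all $i\in[n-1]$. -}

module Defs where

open import Data.Nat using (ℕ; zero; suc; _+_; _∸_; _≤_; _<_; _<?_)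
open import Data.List using (List; []; _∷_; length; filter)
open import Data.List.Relation.Unary.All using (All)
open import Data.Unit using (⊤)
open import Data.Product using (_×_; ∃-syntax)
open import Relation.Binary.PropositionalEquality using (_≡_; _≢_)

-- Partitions are lists of naturals λ = (λ₁,…,λₙ) (stored 0-indexed).
-- Weakly decreasing list.
Decreasing : List ℕ → Set
Decreasing []             = ⊤
Decreasing (x ∷ [])       = ⊤
Decreasing (x ∷ y ∷ rest) = (y ≤ x) × Decreasing (y ∷ rest)

IsPartition : List ℕ → Set
IsPartition λs = All (λ x → 0 < x) λs × Decreasing λs

DDistinct : ℕ → List ℕ → Set
DDistinct D []             = ⊤
DDistinct D (x ∷ [])       = ⊤
DDistinct D (x ∷ y ∷ rest) = (y + D ≤ x) × DDistinct D (y ∷ rest)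

part : List ℕ → ℕ → ℕ
part []       _       = 0
part (x ∷ _)  zero    = x
part (_ ∷ xs) (suc i) = part xs i

colLen : List ℕ → ℕ → ℕ
colLen λs j = length (filter (j <?_) λs)

Cell : List ℕ → ℕ → ℕ → Set
Cell λs i j = j < part λs i

-- hook length: cells weakly to the right in the row + cells strictly below in the column.
hook : List ℕ → ℕ → ℕ → ℕ
hook λs i j = (part λs i ∸ j) + (colLen λs j ∸ suc i)

IsCore : ℕ → ℕ → List ℕ → Set
IsCore S T λs = ∀ i j → Cell λs i j → (hook λs i j ≢ S) × (hook λs i j ≢ T)

Admissible : ℕ → ℕ → ℕ → List ℕ → Set
Admissible D S K λs = IsPartition λs × IsCore S (S + K) λs × DDistinct D λs

IsMaxHook : ℕ → ℕ → ℕ → ℕ → Set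
IsMaxHook D S K h =
  (∃[ λs ] ∃[ i ] ∃[ j ] (Admissible D S K λs × Cell λs i j × hook λs i j ≡ h))
  × (∀ λs i j → Admissible D S K λs → Cell λs i j → hook λs i j ≤ h)

{-# OPTIONS --safe #-}
-- A partition with n parts is determined by its β-numbers β l = λ_l + (n − 1 − l), the hook lengths
-- of its first column, and the hooks in row i are exactly the differences β i − z with z < β i not a
-- β-number. Hence a partition avoiding the hook length t has a β-set closed under subtracting t, and
-- D-distinct parts make distinct β-numbers differ by more than D.
-- For a (bs, b(s+k))-core with bd-distinct parts, write its largest hook β 0 = r + bq with r < b: the
-- numbers r + b(q − n), for n ≤ q in the semigroup ⟨s, s+k⟩, are all β-numbers, so the elements of
-- ⟨s, s+k⟩ up to q are pairwise more than d apart. As gcd(s, k) = 1, ⟨s, s+k⟩ contains two consecutive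
-- numbers, so there is a largest such q, say M, and every hook is at most (b − 1) + bM.
-- Conversely the β-set {(b − 1) + b(M − n) : n ≤ M, n ∈ ⟨s, s+k⟩} has gaps at least b(d + 1), avoids
-- the hooks bs and b(s+k), and has largest hook (b − 1) + bM. So H_D(bs, bk) = (b − 1) + bM for all
-- bd ≤ D < b(d + 1).
module Submission where

open import Defs
open import Data.Nat using (ℕ; zero; suc; _+_; _*_; _∸_; _≤_; _<_; z≤n; s≤s; _<?_; _≟_; pred; NonZero; >-nonZero)
open import Data.Nat.DivMod using (_/_; _%_; m≡m%n+[m/n]*n; m%n<n)
open import Data.Nat.GCD using (gcd; GCD; gcd-GCD; module Bézout)
open import Data.Nat.Properties
open import Data.List using (List; []; _∷_; length; filter; map; upTo)
open import Data.List.Properties using (filter-accept; filter-reject)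
open import Data.List.Relation.Unary.All as All using (All; []; _∷_)
open import Data.List.Relation.Unary.All.Properties as All using ()
open import Data.List.Relation.Unary.Linked as Linked using (Linked; []; [-]; _∷_)
open import Data.List.Relation.Unary.Linked.Properties as Linked using ()
open import Data.List.Membership.Propositional.Properties using (∈-upTo⁺; ∈-upTo⁻; ∈-filter⁻; ∈-map⁻; ∈-map∘filter⁺)
open import Data.List.Relation.Unary.Any using (here; there)
open import Data.List.Membership.Propositional using (_∈_)
open import Data.Product using (_×_; _,_; proj₁; proj₂; ∃-syntax)
open import Data.Empty using (⊥-elim)
open import Function using (_∘_; flip; id)
open import Relation.Nullary using (¬_; Dec; yes; no; contradiction)
open import Relation.Nullary.Decidable using (map′; _→-dec_)
open import Relation.Unary using (Decidable)
open import Relation.Binary.PropositionalEquality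
open import Data.Nat.Tactic.RingSolver using (solve-∀)
open import Algebra.Properties.CommutativeSemigroup +-commutativeSemigroup using (interchange; xy∙z≈xz∙y)

threshold : {Q : ℕ → Set} → Decidable Q → (∀ {l l′} → l ≤ l′ → Q l′ → Q l) → ∀ n → ¬ Q n →
  ∃[ c ] (c ≤ n × (∀ {l} → l < c → Q l) × (∀ {l} → c ≤ l → ¬ Q l))
threshold Q? down zero ¬Q₀ = 0 , z≤n , (λ ()) , λ _ Ql → ¬Q₀ (down z≤n Ql)
threshold Q? down (suc n) ¬Q₁₊ₙ with Q? n
... | yes Qₙ = suc n , ≤-refl , (λ l<1+n → down (≤-pred l<1+n) Qₙ) , λ 1+n≤l Ql → ¬Q₁₊ₙ (down 1+n≤l Ql)
... | no ¬Qₙ with threshold Q? down n ¬Qₙ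
...   | c , c≤n , below , above = c , m≤n⇒m≤1+n c≤n , below , above

greatest : {Q : ℕ → Set} → Decidable Q → (∀ {l l′} → l ≤ l′ → Q l′ → Q l) → Q 0 → ∀ n → ¬ Q n →
  ∃[ m ] (Q m × (∀ {q} → Q q → q ≤ m))
greatest Q? down Q₀ n ¬Qₙ with threshold Q? down n ¬Qₙ
... | zero  , _ , _     , above = ⊥-elim (above z≤n Q₀)
... | suc m , _ , below , above = m , below ≤-refl , λ Qq → ≮⇒≥ (λ m<q → above m<q Qq)

Linked-refine : ∀ {A : Set} {P : A → Set} {R R′ : A → A → Set} → (∀ {x y} → P x → P y → R x y → R′ x y) →
  ∀ {xs} → All P xs → Linked R xs → Linked R′ xs
Linked-refine f _                     []       = []
Linked-refine f _                     [-]      = [-]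
Linked-refine f (px ∷ pys@(py ∷ _)) (r ∷ rs) = f px py r ∷ Linked-refine f pys rs

-- Partitions

part-beyond : ∀ ls {l} → length ls ≤ l → part ls l ≡ 0
part-beyond []       _       = refl
part-beyond (x ∷ xs) (s≤s p) = part-beyond xs p

part-antitone : ∀ {ls} → Decreasing ls → ∀ {i l} → i ≤ l → part ls l ≤ part ls i
part-antitone {[]}          _         _               = z≤n
part-antitone {x ∷ []}      _         {l = zero}  z≤n = ≤-refl
part-antitone {x ∷ []}      _         {l = suc l} _   = z≤n
part-antitone {x ∷ y ∷ ys}  _         {zero} {zero} _ = ≤-refl
part-antitone {x ∷ y ∷ ys}  (y≤x , d) {zero} {suc l} _ = ≤-trans (part-antitone d {0} {l} z≤n) y≤x
part-antitone {x ∷ y ∷ ys}  (_ , d)   {suc i} {suc l} (s≤s i≤l) = part-antitone d i≤l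

part-positive : ∀ {ls} → All (0 <_) ls → ∀ {l} → l < length ls → 0 < part ls l
part-positive (p ∷ _)  {zero}  _         = p
part-positive (_ ∷ ps) {suc l} (s≤s l<n) = part-positive ps l<n

cell⇒row<length : ∀ ls {i j} → Cell ls i j → i < length ls
cell⇒row<length (x ∷ xs) {zero}  _    = s≤s z≤n
cell⇒row<length (x ∷ xs) {suc i} cell = s≤s (cell⇒row<length xs cell)

part-∈ : ∀ L {l} → l < length L → part L l ∈ L
part-∈ (x ∷ xs) {zero}  _         = here refl
part-∈ (x ∷ xs) {suc l} (s≤s l<n) = there (part-∈ xs l<n)

∈⇒part : ∀ {L w} → w ∈ L → ∃[ l ] (l < length L × part L l ≡ w)
∈⇒part (here refl) = 0 , s≤s z≤n , refl
∈⇒part (there w∈xs) with ∈⇒part w∈xs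
... | l , l<n , eq = suc l , s≤s l<n , eq

DDistinct⇒part-gap : ∀ {D} ls → DDistinct D ls → ∀ {i} → suc i < length ls → part ls (suc i) + D ≤ part ls i
DDistinct⇒part-gap (x ∷ [])     _         {zero}  (s≤s ())
DDistinct⇒part-gap (x ∷ y ∷ ys) (gap , _) {zero}  _ = gap
DDistinct⇒part-gap (x ∷ y ∷ ys) (_ , d)   {suc i} (s≤s i<n) = DDistinct⇒part-gap (y ∷ ys) d i<n

DDistinct-tail : ∀ {D} x xs → DDistinct D (x ∷ xs) → DDistinct D xs
DDistinct-tail x []      _       = _
DDistinct-tail x (_ ∷ _) (_ , d) = d

DDistinct-weaken : ∀ {D D′} → D′ ≤ D → ∀ ls → DDistinct D ls → DDistinct D′ ls
DDistinct-weaken _    []           _         = _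
DDistinct-weaken _    (x ∷ [])     _         = _
DDistinct-weaken D′≤D (x ∷ y ∷ ys) (gap , d) = ≤-trans (+-monoʳ-≤ y D′≤D) gap , DDistinct-weaken D′≤D (y ∷ ys) d

DDistinct⇒Decreasing : ∀ {D} ls → DDistinct D ls → Decreasing ls
DDistinct⇒Decreasing []           _         = _
DDistinct⇒Decreasing (x ∷ [])     _         = _
DDistinct⇒Decreasing (x ∷ y ∷ ys) (gap , d) = ≤-trans (m≤m+n y _) gap , DDistinct⇒Decreasing (y ∷ ys) d

Linked⇒DDistinct : ∀ {D xs} → Linked (λ x y → y + D ≤ x) xs → DDistinct D xs
Linked⇒DDistinct []           = _
Linked⇒DDistinct [-]          = _
Linked⇒DDistinct (gap ∷ rest) = gap , Linked⇒DDistinct rest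

colLen≡ : ∀ ls {j c} → (∀ {l} → l < c → j < part ls l) → (∀ {l} → c ≤ l → part ls l ≤ j) → colLen ls j ≡ c
colLen≡ []       {c = zero}  _    _    = refl
colLen≡ []       {c = suc c} long _    = contradiction (long (s≤s z≤n)) λ ()
colLen≡ (x ∷ xs) {j} {zero}  _    short = begin
  length (filter (j <?_) (x ∷ xs)) ≡⟨ cong length (filter-reject (j <?_) (≤⇒≯ (short {0} z≤n))) ⟩
  colLen xs j                      ≡⟨ colLen≡ xs (λ ()) (λ {l} _ → short {suc l} z≤n) ⟩
  0                                ∎
  where open ≡-Reasoning
colLen≡ (x ∷ xs) {j} {suc c} long short = begin
  length (filter (j <?_) (x ∷ xs)) ≡⟨ cong length (filter-accept (j <?_) (long (s≤s z≤n))) ⟩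
  suc (colLen xs j)                ≡⟨ cong suc (colLen≡ xs (λ l<c → long (s≤s l<c)) (λ c≤l → short (s≤s c≤l))) ⟩
  suc c                            ∎
  where open ≡-Reasoning

column-shape : ∀ {ls} → Decreasing ls → ∀ j →
  ∃[ c ] (c ≤ length ls × colLen ls j ≡ c × (∀ {l} → l < c → j < part ls l) × (∀ {l} → c ≤ l → part ls l ≤ j))
column-shape {ls} dec j with threshold (λ l → j <? part ls l) (λ l≤l′ j<p → <-≤-trans j<p (part-antitone dec l≤l′))
                         (length ls) (λ j<p → n≮0 (subst (j <_) (part-beyond ls ≤-refl) j<p))
... | c , c≤n , long , short = c , c≤n , colLen≡ ls long short′ , long , short′
  where
  short′ : ∀ {l} → c ≤ l → part ls l ≤ j
  short′ c≤l = ≮⇒≥ (short c≤l)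

-- β-numbers

β : List ℕ → ℕ → ℕ
β ls l = part ls l + (length ls ∸ suc l)

β-antitone : ∀ {ls} → Decreasing ls → ∀ {i l} → i ≤ l → β ls l ≤ β ls i
β-antitone {ls} dec i≤l = +-mono-≤ (part-antitone dec i≤l) (∸-monoʳ-≤ (length ls) (s≤s i≤l))

β-beyond : ∀ ls {l} → length ls ≤ l → β ls l ≡ 0
β-beyond ls n≤l rewrite part-beyond ls n≤l = m≤n⇒m∸n≡0 (m≤n⇒m≤1+n n≤l)

BetaNumber : List ℕ → ℕ → Set
BetaNumber ls w = ∃[ l ] (l < length ls × β ls l ≡ w)

betaNumber? : ∀ ls → Decidable (BetaNumber ls)
betaNumber? ls w = anyUpTo? (λ l → β ls l ≟ w) (length ls)

hook+offset≡β : ∀ ls {i j c} → colLen ls j ≡ c → c ≤ length ls → i < c → j < part ls i →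
  hook ls i j + (j + (length ls ∸ c)) ≡ β ls i
hook+offset≡β ls {i} {j} refl c≤n i<c j<p = begin
  (part ls i ∸ j) + (c ∸ suc i) + (j + (n ∸ c)) ≡⟨ interchange (part ls i ∸ j) (c ∸ suc i) j (n ∸ c) ⟩
  (part ls i ∸ j + j) + ((c ∸ suc i) + (n ∸ c)) ≡⟨ cong₂ _+_ (m∸n+n≡m (<⇒≤ j<p)) column-split ⟩
  part ls i + (n ∸ suc i)                       ∎
  where
  open ≡-Reasoning
  n = length ls
  c = colLen ls j
  column-split : (c ∸ suc i) + (n ∸ c) ≡ n ∸ suc i
  column-split = begin
    (c ∸ suc i) + (n ∸ c) ≡⟨ +-comm (c ∸ suc i) (n ∸ c) ⟩
    (n ∸ c) + (c ∸ suc i) ≡⟨ sym (+-∸-assoc (n ∸ c) i<c) ⟩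
    (n ∸ c) + c ∸ suc i   ≡⟨ cong (_∸ suc i) (m∸n+n≡m c≤n) ⟩
    n ∸ suc i             ∎

hook-complement : ∀ {ls} → IsPartition ls → ∀ {i j} → Cell ls i j →
  ∃[ z ] (hook ls i j + z ≡ β ls i × ¬ BetaNumber ls z)
hook-complement {ls} (_ , dec) {i} {j} cell with column-shape dec j
... | c , c≤n , colLen≡c , long , short = j + (n ∸ c) , hook+offset≡β ls colLen≡c c≤n i<c cell , notBeta
  where
  n = length ls
  i<c : i < c
  i<c = ≰⇒> (λ c≤i → <⇒≱ cell (short c≤i))
  notBeta : ¬ BetaNumber ls (j + (n ∸ c))
  notBeta (l , l<n , βl≡) with l <? c
  ... | yes l<c = <⇒≢ (+-mono-<-≤ (long l<c) (∸-monoʳ-≤ n l<c)) (sym βl≡)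
  ... | no l≮c  = <⇒≢ (+-mono-≤-< (short c≤l) (∸-monoʳ-< (s≤s c≤l) l<n)) βl≡
    where c≤l = ≮⇒≥ l≮c

hook-of-gap : ∀ {ls} → IsPartition ls → ∀ {i z} → i < length ls → z < β ls i → ¬ BetaNumber ls z →
  ∃[ j ] (Cell ls i j × hook ls i j + z ≡ β ls i)
hook-of-gap {ls} (_ , dec) {i} {z} i<n z<βi z∉β
  with threshold (λ l → z <? β ls l) (λ l≤l′ z<β → <-≤-trans z<β (β-antitone dec l≤l′))
                 (length ls) (λ z<β → n≮0 (subst (z <_) (β-beyond ls ≤-refl) z<β))
... | zero  , _   , _     , notAbove = ⊥-elim (notAbove z≤n z<βi)
... | suc c , c<n , above , notAbove = j , long i≤c , hook+z≡β
  -- Exactly suc c β-numbers exceed z; the required cell lies in column j, which has length suc c.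
  where
  n = length ls
  j = z ∸ (n ∸ suc c)
  i≤c : i ≤ c
  i≤c = ≤-pred (≰⇒> (λ c≤i → notAbove c≤i z<βi))
  next-row-below : suc c < n → part ls (suc c) + (n ∸ suc c) ≤ z
  next-row-below c+1<n = begin
    part ls (suc c) + (n ∸ suc c)              ≡⟨ cong (part ls (suc c) +_) (+-∸-assoc 1 c+1<n) ⟩
    part ls (suc c) + suc (n ∸ suc (suc c))    ≡⟨ +-suc (part ls (suc c)) _ ⟩
    suc (β ls (suc c))                         ≤⟨ ≤∧≢⇒< (≮⇒≥ (notAbove ≤-refl)) (λ eq → z∉β (suc c , c+1<n , eq)) ⟩
    z                                          ∎
    where open ≤-Reasoning
  offset≤z : n ∸ suc c ≤ z
  offset≤z with suc c <? n
  ... | yes c+1<n = ≤-trans (m≤n+m _ _) (next-row-below c+1<n)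
  ... | no c+1≮n  = ≤-trans (≤-reflexive (m≤n⇒m∸n≡0 (≮⇒≥ c+1≮n))) z≤n
  long : ∀ {l} → l ≤ c → j < part ls l
  long l≤c = <-≤-trans (+-cancelʳ-< (n ∸ suc c) j (part ls c) j+offset<βc) (part-antitone dec l≤c)
    where
    j+offset<βc : j + (n ∸ suc c) < β ls c
    j+offset<βc = subst (_< β ls c) (sym (m∸n+n≡m offset≤z)) (above ≤-refl)
  long′ : ∀ {l} → l < suc c → j < part ls l
  long′ l<c+1 = long (≤-pred l<c+1)
  short : ∀ {l} → suc c ≤ l → part ls l ≤ j
  short {l} c+1≤l with suc c <? n
  ... | yes c+1<n = ≤-trans (part-antitone dec c+1≤l) (m+n≤o⇒m≤o∸n _ (next-row-below c+1<n))
  ... | no c+1≮n  = ≤-trans (≤-reflexive (part-beyond ls (≤-trans (≮⇒≥ c+1≮n) c+1≤l))) z≤n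
  hook+z≡β : hook ls i j + z ≡ β ls i
  hook+z≡β = begin
    hook ls i j + z                 ≡⟨ cong (hook ls i j +_) (sym (m∸n+n≡m offset≤z)) ⟩
    hook ls i j + (j + (n ∸ suc c)) ≡⟨ hook+offset≡β ls (colLen≡ ls long′ short) c<n (s≤s i≤c) (long i≤c) ⟩
    β ls i                          ∎
    where open ≡-Reasoning

hook≤β : ∀ {ls} → IsPartition ls → ∀ {i j} → Cell ls i j → hook ls i j ≤ β ls i
hook≤β {ls} P {i} {j} cell with hook-complement P cell
... | z , hook+z≡β , _ = subst (hook ls i j ≤_) hook+z≡β (m≤m+n (hook ls i j) z)

hook-first-column : ∀ {ls} → IsPartition ls → ∀ {i} → i < length ls → Cell ls i 0 × hook ls i 0 ≡ β ls i
hook-first-column {ls} (pos , _) {i} i<n = cell , (begin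
  hook ls i 0                          ≡⟨ sym (+-identityʳ _) ⟩
  hook ls i 0 + 0                      ≡⟨ cong (hook ls i 0 +_) (sym (n∸n≡0 n)) ⟩
  hook ls i 0 + (0 + (n ∸ n))          ≡⟨ hook+offset≡β ls (colLen≡ ls (part-positive pos) short) ≤-refl i<n cell ⟩
  β ls i                               ∎)
  where
  open ≡-Reasoning
  n = length ls
  cell = part-positive pos i<n
  short : ∀ {l} → n ≤ l → part ls l ≤ 0
  short n≤l = ≤-reflexive (part-beyond ls n≤l)

β-gap : ∀ {D ls} → IsPartition ls → DDistinct D ls → ∀ {i l} → i < l → l < length ls → β ls l + D < β ls i
β-gap {D} {ls} (_ , dec) dd {i} {l} i<l l<n = begin-strict
  part ls l + (n ∸ suc l) + D  ≡⟨ xy∙z≈xz∙y (part ls l) (n ∸ suc l) D ⟩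
  part ls l + D + (n ∸ suc l)  <⟨ +-mono-≤-< part-gap (∸-monoʳ-< (s≤s i<l) l<n) ⟩
  part ls i + (n ∸ suc i)      ∎
  where
  open ≤-Reasoning
  n = length ls
  part-gap : part ls l + D ≤ part ls i
  part-gap = ≤-trans (+-monoˡ-≤ D (part-antitone dec i<l)) (DDistinct⇒part-gap ls dd (≤-<-trans i<l l<n))

betaNumber-gap : ∀ {D ls} → IsPartition ls → DDistinct D ls → ∀ {w₁ w₂} →
  BetaNumber ls w₁ → BetaNumber ls w₂ → w₂ < w₁ → w₂ + D < w₁
betaNumber-gap P dd (l₁ , _ , refl) (l₂ , l₂<n , refl) w₂<w₁ with l₁ <? l₂
... | yes l₁<l₂ = β-gap P dd l₁<l₂ l₂<n
... | no l₁≮l₂  = contradiction (β-antitone (proj₂ P) (≮⇒≥ l₁≮l₂)) (<⇒≱ w₂<w₁)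

core-closed : ∀ {ls} → IsPartition ls → ∀ {t} → 0 < t → (∀ {i j} → Cell ls i j → hook ls i j ≢ t) →
  ∀ w → BetaNumber ls (w + t) → BetaNumber ls w
core-closed {ls} P {t} t>0 avoids w (l , l<n , βl≡w+t) with betaNumber? ls w
... | yes w∈β = w∈β
... | no w∉β with hook-of-gap P l<n (subst (w <_) (sym βl≡w+t) (m<m+n w t>0)) w∉β
...   | j , cell , hook+w≡βl = contradiction (+-cancelʳ-≡ w _ _ hook+w≡w+t) (avoids cell)
  where
  hook+w≡w+t : hook ls l j + w ≡ t + w
  hook+w≡w+t = trans hook+w≡βl (trans βl≡w+t (+-comm w t))

-- The partition with a prescribed β-set

fromBeta : List ℕ → List ℕ
fromBeta []       = []
fromBeta (x ∷ xs) = (x ∸ length xs) ∷ fromBeta xs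

length-fromBeta : ∀ L → length (fromBeta L) ≡ length L
length-fromBeta []       = refl
length-fromBeta (x ∷ xs) = cong suc (length-fromBeta xs)

length<head : ∀ x xs → All (0 <_) (x ∷ xs) → DDistinct 1 (x ∷ xs) → length xs < x
length<head x []       (x>0 ∷ _) _         = x>0
length<head x (y ∷ ys) (_ ∷ pos) (gap , d) = ≤-trans (s≤s (length<head y ys pos d)) (subst (_≤ x) (+-comm y 1) gap)

β-fromBeta : ∀ L → All (0 <_) L → DDistinct 1 L → ∀ t → β (fromBeta L) t ≡ part L t
β-fromBeta []       _         _ _       = refl
β-fromBeta (x ∷ xs) pos       d zero    rewrite length-fromBeta xs = m∸n+n≡m (<⇒≤ (length<head x xs pos d))
β-fromBeta (x ∷ xs) (_ ∷ pos) d (suc t) = β-fromBeta xs pos (DDistinct-tail x xs d) t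

fromBeta-positive : ∀ L → All (0 <_) L → DDistinct 1 L → All (0 <_) (fromBeta L)
fromBeta-positive []       _               _ = []
fromBeta-positive (x ∷ xs) pos@(_ ∷ pos′) d =
  m<n⇒0<n∸m (length<head x xs pos d) ∷ fromBeta-positive xs pos′ (DDistinct-tail x xs d)

fromBeta-DDistinct : ∀ {D} L → All (0 <_) L → DDistinct (suc D) L → DDistinct D (fromBeta L)
fromBeta-DDistinct []           _         _         = _
fromBeta-DDistinct (x ∷ [])     _         _         = _
fromBeta-DDistinct {D} (x ∷ y ∷ ys) (_ ∷ pos) (gap , d) =
  m+n≤o⇒m≤o∸n _ shifted-gap , fromBeta-DDistinct (y ∷ ys) pos d
  where
  m = length ys
  m≤y : m ≤ y
  m≤y = <⇒≤ (length<head y ys pos (DDistinct-weaken (s≤s z≤n) (y ∷ ys) d))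
  shifted-gap : (y ∸ m) + D + suc m ≤ x
  shifted-gap = begin
    (y ∸ m) + D + suc m    ≡⟨ +-suc (y ∸ m + D) m ⟩
    suc (y ∸ m + D + m)    ≡⟨ cong suc (xy∙z≈xz∙y (y ∸ m) D m) ⟩
    suc (y ∸ m + m + D)    ≡⟨ cong (λ a → suc (a + D)) (m∸n+n≡m m≤y) ⟩
    suc (y + D)            ≡⟨ sym (+-suc y D) ⟩
    y + suc D              ≤⟨ gap ⟩
    x                      ∎
    where open ≤-Reasoning

fromBeta-partition : ∀ L → All (0 <_) L → DDistinct 1 L → IsPartition (fromBeta L)
fromBeta-partition L pos d = fromBeta-positive L pos d , DDistinct⇒Decreasing (fromBeta L) (fromBeta-DDistinct L pos d)

betaNumber-fromBeta⇒∈ : ∀ L → All (0 <_) L → DDistinct 1 L → ∀ {w} → BetaNumber (fromBeta L) w → w ∈ L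
betaNumber-fromBeta⇒∈ L pos d (l , l<n , refl) =
  subst (_∈ L) (sym (β-fromBeta L pos d l)) (part-∈ L (subst (l <_) (length-fromBeta L) l<n))

∈⇒betaNumber-fromBeta : ∀ L → All (0 <_) L → DDistinct 1 L → ∀ {w} → w ∈ L → BetaNumber (fromBeta L) w
∈⇒betaNumber-fromBeta L pos d w∈L with ∈⇒part w∈L
... | l , l<n , refl = l , subst (l <_) (sym (length-fromBeta L)) l<n , β-fromBeta L pos d l

-- The semigroup generated by two numbers

Generated : ℕ → ℕ → ℕ → Set
Generated t₁ t₂ n = ∃[ a ] ∃[ e ] a * t₁ + e * t₂ ≡ n

module _ {t₁ t₂ : ℕ} where

  generated-zero : Generated t₁ t₂ 0
  generated-zero = 0 , 0 , refl

  generated-+₁ : ∀ {n} → Generated t₁ t₂ n → Generated t₁ t₂ (n + t₁)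
  generated-+₁ (a , e , refl) = suc a , e , step a e t₁ t₂
    where
    step : ∀ a e t₁ t₂ → suc a * t₁ + e * t₂ ≡ a * t₁ + e * t₂ + t₁
    step = solve-∀

  generated-+₂ : ∀ {n} → Generated t₁ t₂ n → Generated t₁ t₂ (n + t₂)
  generated-+₂ (a , e , refl) = a , suc e , step a e t₁ t₂
    where
    step : ∀ a e t₁ t₂ → a * t₁ + suc e * t₂ ≡ a * t₁ + e * t₂ + t₂
    step = solve-∀

  generated? : 0 < t₁ → 0 < t₂ → Decidable (Generated t₁ t₂)
  generated? t₁>0 t₂>0 n =
    map′ (λ (a , _ , e , _ , eq) → a , e , eq) (λ (a , e , eq) → a , bound₁ {a} {e} eq , e , bound₂ {a} {e} eq , eq)
         (anyUpTo? (λ a → anyUpTo? (λ e → a * t₁ + e * t₂ ≟ n) (suc n)) (suc n))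
    where
    bound₁ : ∀ {a e} → a * t₁ + e * t₂ ≡ n → a < suc n
    bound₁ {a} refl = s≤s (≤-trans (m≤m*n a t₁ {{>-nonZero t₁>0}}) (m≤m+n _ _))
    bound₂ : ∀ {a e} → a * t₁ + e * t₂ ≡ n → e < suc n
    bound₂ {e = e} refl = s≤s (≤-trans (m≤m*n e t₂ {{>-nonZero t₂>0}}) (m≤n+m _ _))

  generated-scale : ∀ b {n} → Generated t₁ t₂ n → Generated (b * t₁) (b * t₂) (b * n)
  generated-scale b (a , e , refl) = a , e , scale a e b t₁ t₂
    where
    scale : ∀ a e b t₁ t₂ → a * (b * t₁) + e * (b * t₂) ≡ b * (a * t₁ + e * t₂)
    scale = solve-∀

  generated-closed : (P : ℕ → Set) → (∀ w → P (w + t₁) → P w) → (∀ w → P (w + t₂) → P w) →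
    ∀ {n} → Generated t₁ t₂ n → ∀ w → P (w + n) → P w
  generated-closed P down₁ down₂ (a , e , refl) = descend a e
    where
    descend : ∀ a e w → P (w + (a * t₁ + e * t₂)) → P w
    descend zero    zero    w = subst P (+-identityʳ w)
    descend zero    (suc e) w = descend zero e w ∘ down₂ _ ∘ subst P (step₂ w e t₁ t₂)
      where
      step₂ : ∀ w e t₁ t₂ → w + (0 * t₁ + suc e * t₂) ≡ w + (0 * t₁ + e * t₂) + t₂
      step₂ = solve-∀
    descend (suc a) e       w = descend a e w ∘ down₁ _ ∘ subst P (step₁ w a e t₁ t₂)
      where
      step₁ : ∀ w a e t₁ t₂ → w + (suc a * t₁ + e * t₂) ≡ w + (a * t₁ + e * t₂) + t₁
      step₁ = solve-∀

consecutive-generated : ∀ {s k} → gcd s k ≡ 1 → ∃[ n ] (Generated s (s + k) n × Generated s (s + k) (suc n))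
consecutive-generated {s} {k} gcd≡1 with Bézout.identity (subst (GCD s k) gcd≡1 (gcd-GCD s k))
... | Bézout.+- x y 1+yk≡xs = y * (s + k) , (0 , y , refl) , (x + y , 0 , sum≡)
  where
  open ≡-Reasoning
  sum≡ : (x + y) * s + 0 * (s + k) ≡ suc (y * (s + k))
  sum≡ = begin
    (x + y) * s + 0     ≡⟨ +-identityʳ _ ⟩
    (x + y) * s         ≡⟨ *-distribʳ-+ s x y ⟩
    x * s + y * s       ≡⟨ cong (_+ y * s) (sym 1+yk≡xs) ⟩
    suc (y * k + y * s) ≡⟨ cong suc (+-comm (y * k) (y * s)) ⟩
    suc (y * s + y * k) ≡⟨ cong suc (sym (*-distribˡ-+ y s k)) ⟩
    suc (y * (s + k))   ∎
... | Bézout.-+ x y 1+xs≡yk = (x + y) * s , (x + y , 0 , +-identityʳ _) , (0 , y , sum≡)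
  where
  open ≡-Reasoning
  sum≡ : 0 * s + y * (s + k) ≡ suc ((x + y) * s)
  sum≡ = begin
    y * (s + k)         ≡⟨ *-distribˡ-+ y s k ⟩
    y * s + y * k       ≡⟨ cong (y * s +_) (sym 1+xs≡yk) ⟩
    y * s + suc (x * s) ≡⟨ +-suc (y * s) (x * s) ⟩
    suc (y * s + x * s) ≡⟨ cong suc (+-comm (y * s) (x * s)) ⟩
    suc (x * s + y * s) ≡⟨ cong suc (sym (*-distribʳ-+ s x y)) ⟩
    suc ((x + y) * s)   ∎

Separated : ℕ → ℕ → ℕ → ℕ → Set
Separated d t₁ t₂ q = ∀ {n₁ n₂} → n₁ < n₂ → n₂ ≤ q → Generated t₁ t₂ n₁ → Generated t₁ t₂ n₂ → d + n₁ < n₂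

module _ {d t₁ t₂ : ℕ} where

  separated? : 0 < t₁ → 0 < t₂ → Decidable (Separated d t₁ t₂)
  separated? t₁>0 t₂>0 q = map′ to from (allUpTo? (λ n₂ → allUpTo? (λ n₁ → pair? n₁ n₂) n₂) (suc q))
    where
    Pair : ℕ → ℕ → Set
    Pair n₁ n₂ = Generated t₁ t₂ n₁ → Generated t₁ t₂ n₂ → d + n₁ < n₂
    pair? : ∀ n₁ n₂ → Dec (Pair n₁ n₂)
    pair? n₁ n₂ = generated? t₁>0 t₂>0 n₁ →-dec (generated? t₁>0 t₂>0 n₂ →-dec (d + n₁ <? n₂))
    to : (∀ {n₂} → n₂ < suc q → ∀ {n₁} → n₁ < n₂ → Pair n₁ n₂) → Separated d t₁ t₂ q
    to sep n₁<n₂ n₂≤q = sep (s≤s n₂≤q) n₁<n₂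
    from : Separated d t₁ t₂ q → ∀ {n₂} → n₂ < suc q → ∀ {n₁} → n₁ < n₂ → Pair n₁ n₂
    from sep n₂<1+q n₁<n₂ = sep n₁<n₂ (≤-pred n₂<1+q)

  separated-antitone : ∀ {q q′} → q ≤ q′ → Separated d t₁ t₂ q′ → Separated d t₁ t₂ q
  separated-antitone q≤q′ sep n₁<n₂ n₂≤q = sep n₁<n₂ (≤-trans n₂≤q q≤q′)

  separated-zero : Separated d t₁ t₂ 0
  separated-zero n₁<n₂ z≤n = contradiction n₁<n₂ n≮0

  ¬separated-consecutive : 0 < d → ∀ {n} → Generated t₁ t₂ n → Generated t₁ t₂ (suc n) → ¬ Separated d t₁ t₂ (suc n)
  ¬separated-consecutive d>0 {n} gₙ g₁₊ₙ sep = <⇒≱ d>0 (+-cancelʳ-≤ n d 0 (≤-pred (sep ≤-refl ≤-refl gₙ g₁₊ₙ)))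

  largest-separated : 0 < d → 0 < t₁ → 0 < t₂ → ∃[ n ] (Generated t₁ t₂ n × Generated t₁ t₂ (suc n)) →
    ∃[ M ] (Separated d t₁ t₂ M × (∀ {q} → Separated d t₁ t₂ q → q ≤ M))
  largest-separated d>0 t₁>0 t₂>0 (n , gₙ , g₁₊ₙ) =
    greatest (separated? t₁>0 t₂>0) separated-antitone separated-zero (suc n) (¬separated-consecutive d>0 gₙ g₁₊ₙ)

-- The maximal hook length

r+b*[u∸m]+b*m≡r+b*u : ∀ r b {m u} → m ≤ u → r + b * (u ∸ m) + b * m ≡ r + b * u
r+b*[u∸m]+b*m≡r+b*u r b {m} {u} m≤u = begin
  r + b * (u ∸ m) + b * m   ≡⟨ +-assoc r _ _ ⟩
  r + (b * (u ∸ m) + b * m) ≡⟨ cong (r +_) (sym (*-distribˡ-+ b (u ∸ m) m)) ⟩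
  r + b * (u ∸ m + m)       ≡⟨ cong (λ v → r + b * v) (m∸n+n≡m m≤u) ⟩
  r + b * u                 ∎
  where open ≡-Reasoning

z+b*m≡r+b*u⇒m≤u : ∀ {z b m r u} → r < b → z + b * m ≡ r + b * u → m ≤ u
z+b*m≡r+b*u⇒m≤u {z} {b} {m} {r} {u} r<b eq = ≮⇒≥ λ u<m → <-irrefl refl (begin-strict
  r + b * u   <⟨ +-monoˡ-< (b * u) r<b ⟩
  b + b * u   ≡⟨ sym (*-suc b u) ⟩
  b * suc u   ≤⟨ *-monoʳ-≤ b u<m ⟩
  b * m       ≤⟨ m≤n+m (b * m) z ⟩
  z + b * m   ≡⟨ eq ⟩
  r + b * u   ∎)
  where open ≤-Reasoning

z+b*m≡r+b*u⇒z≡r+b*[u∸m] : ∀ {z b m r u} → r < b → z + b * m ≡ r + b * u → z ≡ r + b * (u ∸ m)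
z+b*m≡r+b*u⇒z≡r+b*[u∸m] {z} {b} {m} {r} {u} r<b eq =
  +-cancelʳ-≡ (b * m) z _ (trans eq (sym (r+b*[u∸m]+b*m≡r+b*u r b (z+b*m≡r+b*u⇒m≤u r<b eq))))

m+n≡o+p∧n<p⇒o<m : ∀ {m n o p} → m + n ≡ o + p → n < p → o < m
m+n≡o+p∧n<p⇒o<m eq n<p = ≰⇒> λ m≤o → <⇒≢ (+-mono-≤-< m≤o n<p) eq

m+n≡o+p∧o+k<m⇒k+n<p : ∀ {m n o p k} → m + n ≡ o + p → o + k < m → k + n < p
m+n≡o+p∧o+k<m⇒k+n<p {m} {n} {o} {p} {k} eq o+k<m = +-cancelˡ-< o (k + n) p (begin-strict
  o + (k + n)  ≡⟨ sym (+-assoc o k n) ⟩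
  o + k + n    <⟨ +-monoˡ-< n o+k<m ⟩
  m + n        ≡⟨ eq ⟩
  o + p        ∎)
  where open ≤-Reasoning

module _ {s k d b : ℕ} (s>0 : 0 < s) (b>0 : 0 < b) where

  private instance
    b≢0 : NonZero b
    b≢0 = >-nonZero b>0

  multiple-closed : ∀ {ls} → IsPartition ls → IsCore (b * s) (b * s + b * k) ls →
    ∀ {n} → Generated s (s + k) n → ∀ w → BetaNumber ls (w + b * n) → BetaNumber ls w
  multiple-closed {ls} P core g =
    generated-closed (BetaNumber ls) (core-closed P (*-mono-≤ b>0 s>0) (λ cell → proj₁ (core _ _ cell)))
      (core-closed P (*-mono-≤ b>0 (≤-trans s>0 (m≤m+n s k))) (λ cell → avoids (proj₂ (core _ _ cell))))
      (generated-scale b g)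
    where
    avoids : ∀ {h} → h ≢ b * s + b * k → h ≢ b * (s + k)
    avoids h≢ = h≢ ∘ flip trans (*-distribˡ-+ b s k)

  separated-of-core : ∀ {ls} → Admissible (b * d) (b * s) (b * k) ls →
    ∀ {r q} → BetaNumber ls (r + b * q) → Separated d s (s + k) q
  separated-of-core {ls} (P , core , dd) {r} {q} top {n₁} {n₂} n₁<n₂ n₂≤q g₁ g₂ =
    *-cancelˡ-< b (d + n₁) n₂ (subst (_< b * n₂) (sym (*-distribˡ-+ b d n₁)) bd+bn₁<bn₂)
    where
    w : ℕ → ℕ
    w n = r + b * (q ∸ n)
    below-top : ∀ {n} → n ≤ q → w n + b * n ≡ r + b * q
    below-top = r+b*[u∸m]+b*m≡r+b*u r b
    w-beta : ∀ {n} → n ≤ q → Generated s (s + k) n → BetaNumber ls (w n)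
    w-beta {n} n≤q g = multiple-closed P core g (w n) (subst (BetaNumber ls) (sym (below-top n≤q)) top)
    n₁≤q = ≤-trans (<⇒≤ n₁<n₂) n₂≤q
    balance : w n₁ + b * n₁ ≡ w n₂ + b * n₂
    balance = trans (below-top n₁≤q) (sym (below-top n₂≤q))
    w₂<w₁ : w n₂ < w n₁
    w₂<w₁ = m+n≡o+p∧n<p⇒o<m balance (*-monoʳ-< b n₁<n₂)
    bd+bn₁<bn₂ : b * d + b * n₁ < b * n₂
    bd+bn₁<bn₂ = m+n≡o+p∧o+k<m⇒k+n<p balance (betaNumber-gap P dd (w-beta n₁≤q g₁) (w-beta n₂≤q g₂) w₂<w₁)

  β-bound : ∀ {M} → (∀ {q} → Separated d s (s + k) q → q ≤ M) →
    ∀ {ls} → Admissible (b * d) (b * s) (b * k) ls → ∀ {i} → i < length ls → β ls i ≤ pred b + b * M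
  β-bound {M} maximal {ls} adm {i} i<n = begin
    β ls i            ≡⟨ β≡r+b*q ⟩
    r + b * q         ≤⟨ +-mono-≤ (<⇒≤pred (m%n<n (β ls i) b)) (*-monoʳ-≤ b (maximal (separated-of-core adm top))) ⟩
    pred b + b * M    ∎
    where
    open ≤-Reasoning
    r = β ls i % b
    q = β ls i / b
    β≡r+b*q : β ls i ≡ r + b * q
    β≡r+b*q = trans (m≡m%n+[m/n]*n (β ls i) b) (cong (r +_) (*-comm q b))
    top : BetaNumber ls (r + b * q)
    top = i , i<n , β≡r+b*q

module Extremal {s k d b M : ℕ} (s>0 : 0 < s) (1<b : 1 < b) (sep : Separated d s (s + k) M) where

  private
    b>0 : 0 < b
    b>0 = <-trans (s≤s z≤n) 1<b
    s+k>0 : 0 < s + k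
    s+k>0 = ≤-trans s>0 (m≤m+n s k)
    generated?ₛ : Decidable (Generated s (s + k))
    generated?ₛ = generated? s>0 s+k>0

  level : ℕ → ℕ
  level n = pred b + b * (M ∸ n)

  indices : List ℕ
  indices = filter generated?ₛ (upTo (suc M))

  betaSet : List ℕ
  betaSet = map level indices

  extremal : List ℕ
  extremal = fromBeta betaSet

  index-bounded : ∀ {n} → n ∈ indices → n ≤ M × Generated s (s + k) n
  index-bounded n∈ with ∈-filter⁻ generated?ₛ n∈
  ... | n∈upTo , g = ≤-pred (∈-upTo⁻ n∈upTo) , g

  ∈betaSet⇒level : ∀ {w} → w ∈ betaSet → ∃[ n ] (n ≤ M × Generated s (s + k) n × w ≡ level n)
  ∈betaSet⇒level w∈ with ∈-map⁻ level w∈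
  ... | n , n∈indices , w≡ = n , proj₁ (index-bounded n∈indices) , proj₂ (index-bounded n∈indices) , w≡

  level∈betaSet : ∀ {n} → n ≤ M → Generated s (s + k) n → level n ∈ betaSet
  level∈betaSet n≤M g = ∈-map∘filter⁺ level generated?ₛ (_ , ∈-upTo⁺ (s≤s n≤M) , refl , g)

  level-gap : ∀ {n₁ n₂} → d + n₁ < n₂ → n₂ ≤ M → level n₂ + b * suc d ≤ level n₁
  level-gap {n₁} {n₂} d+n₁<n₂ n₂≤M = begin
    pred b + b * (M ∸ n₂) + b * suc d   ≡⟨ +-assoc (pred b) _ _ ⟩
    pred b + (b * (M ∸ n₂) + b * suc d) ≡⟨ cong (pred b +_) (sym (*-distribˡ-+ b (M ∸ n₂) (suc d))) ⟩
    pred b + b * (M ∸ n₂ + suc d)       ≤⟨ +-monoʳ-≤ (pred b) (*-monoʳ-≤ b (m+n≤o⇒m≤o∸n _ spread)) ⟩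
    pred b + b * (M ∸ n₁)               ∎
    where
    open ≤-Reasoning
    spread : M ∸ n₂ + suc d + n₁ ≤ M
    spread = begin
      M ∸ n₂ + suc d + n₁   ≡⟨ +-assoc (M ∸ n₂) (suc d) n₁ ⟩
      M ∸ n₂ + suc (d + n₁) ≤⟨ +-monoʳ-≤ (M ∸ n₂) d+n₁<n₂ ⟩
      M ∸ n₂ + n₂           ≡⟨ m∸n+n≡m n₂≤M ⟩
      M                     ∎

  betaSet-positive : All (0 <_) betaSet
  betaSet-positive = All.map⁺ (All.universal (λ _ → ≤-trans (suc[m]≤n⇒m≤pred[n] 1<b) (m≤m+n _ _)) indices)

  betaSet-DDistinct : DDistinct (b * suc d) betaSet
  betaSet-DDistinct = Linked⇒DDistinct (Linked.map⁺ (Linked-refine gapped (All.tabulate index-bounded) increasing))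
    where
    increasing : Linked _<_ indices
    increasing = Linked.filter⁺ generated?ₛ <-trans (Linked.applyUpTo⁺₂ id (suc M) n<1+n)
    gapped : ∀ {n₁ n₂} → n₁ ≤ M × Generated s (s + k) n₁ → n₂ ≤ M × Generated s (s + k) n₂ → n₁ < n₂ →
      level n₂ + b * suc d ≤ level n₁
    gapped (_ , g₁) (n₂≤M , g₂) n₁<n₂ = level-gap (sep n₁<n₂ n₂≤M g₁ g₂) n₂≤M

  private
    betaSet-1-distinct : DDistinct 1 betaSet
    betaSet-1-distinct = DDistinct-weaken {D′ = 1} (*-mono-≤ b>0 (s≤s z≤n)) betaSet betaSet-DDistinct

  extremal-partition : IsPartition extremal
  extremal-partition = fromBeta-partition betaSet betaSet-positive betaSet-1-distinct

  extremal-DDistinct : ∀ {D} → suc D ≤ b * suc d → DDistinct D extremal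
  extremal-DDistinct D<b[d+1] = fromBeta-DDistinct betaSet betaSet-positive (DDistinct-weaken D<b[d+1] betaSet betaSet-DDistinct)

  hook≢multiple : ∀ {m} → (∀ {n} → Generated s (s + k) n → Generated s (s + k) (n + m)) →
    ∀ {i j} → Cell extremal i j → hook extremal i j ≢ b * m
  hook≢multiple {m} shift {i} {j} cell hook≡bm with hook-complement extremal-partition cell
  ... | z , hook+z≡βi , z∉β with ∈betaSet⇒level (betaNumber-fromBeta⇒∈ betaSet betaSet-positive betaSet-1-distinct
                                                   (i , cell⇒row<length extremal cell , refl))
  ...   | n , n≤M , g , βi≡level =
    z∉β (∈⇒betaNumber-fromBeta betaSet betaSet-positive betaSet-1-distinct
           (subst (_∈ betaSet) (sym z≡level) (level∈betaSet n+m≤M (shift g))))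
    where
    pred[b]<b : pred b < b
    pred[b]<b = m≤pred[n]⇒suc[m]≤n {{>-nonZero b>0}} ≤-refl
    z+bm≡level : z + b * m ≡ pred b + b * (M ∸ n)
    z+bm≡level = trans (+-comm z (b * m)) (trans (cong (_+ z) (sym hook≡bm)) (trans hook+z≡βi βi≡level))
    n+m≤M : n + m ≤ M
    n+m≤M = subst (_≤ M) (+-comm m n) (m≤o∸n⇒m+n≤o m n≤M (z+b*m≡r+b*u⇒m≤u pred[b]<b z+bm≡level))
    z≡level : z ≡ level (n + m)
    z≡level = trans (z+b*m≡r+b*u⇒z≡r+b*[u∸m] pred[b]<b z+bm≡level) (cong (λ u → pred b + b * u) (∸-+-assoc M n m))

  extremal-core : IsCore (b * s) (b * s + b * k) extremal
  extremal-core i j cell =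
    hook≢multiple generated-+₁ cell , λ hook≡ → hook≢multiple generated-+₂ cell (trans hook≡ (sym (*-distribˡ-+ b s k)))

  extremal-admissible : ∀ {D} → suc D ≤ b * suc d → Admissible D (b * s) (b * k) extremal
  extremal-admissible D<b[d+1] = extremal-partition , extremal-core , extremal-DDistinct D<b[d+1]

  extremal-hook : ∃[ i ] ∃[ j ] (Cell extremal i j × hook extremal i j ≡ pred b + b * M)
  extremal-hook with ∈⇒betaNumber-fromBeta betaSet betaSet-positive betaSet-1-distinct (level∈betaSet z≤n generated-zero)
  ... | l , l<n , βl≡ with hook-first-column extremal-partition l<n
  ...   | cell , hook≡βl = l , 0 , cell , trans hook≡βl βl≡

maxHook-on-block : ∀ {s k d b} → 0 < s → 0 < d → gcd s k ≡ 1 → 1 < b →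
  ∃[ h ] (∀ {D} → b * d ≤ D → D < b * suc d → IsMaxHook D (b * s) (b * k) h)
maxHook-on-block {s} {k} {d} {b} s>0 d>0 gcd≡1 1<b
  with largest-separated d>0 s>0 (≤-trans s>0 (m≤m+n s k)) (consecutive-generated {s} {k} gcd≡1)
... | M , sep , maximal = pred b + b * M , λ bd≤D D<b[d+1] → attained D<b[d+1] , bounded bd≤D
  where
  open Extremal s>0 1<b sep
  attained : ∀ {D} → D < b * suc d →
    ∃[ ls ] ∃[ i ] ∃[ j ] (Admissible D (b * s) (b * k) ls × Cell ls i j × hook ls i j ≡ pred b + b * M)
  attained {D} D<b[d+1] with extremal-hook
  ... | i , j , cell , hook≡ = extremal , i , j , extremal-admissible {D} D<b[d+1] , cell , hook≡
  bounded : ∀ {D} → b * d ≤ D → ∀ ls i j → Admissible D (b * s) (b * k) ls → Cell ls i j → hook ls i j ≤ pred b + b * M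
  bounded bd≤D ls i j (P , core , dd) cell =
    ≤-trans (hook≤β P cell) (β-bound s>0 (<-trans (s≤s z≤n) 1<b) maximal (P , core , DDistinct-weaken bd≤D ls dd) (cell⇒row<length ls cell))

lemma4p2 : (s k d b c : ℕ) → 0 < s → 0 < k → 0 < d → gcd s k ≡ 1 → 2 ≤ s → 2 ≤ b → c < b →
    ∃[ h ] (IsMaxHook (b * d + c) (b * s) (b * k) h × IsMaxHook (b * d) (b * s) (b * k) h)
lemma4p2 s k d b c s>0 _ d>0 gcd≡1 _ 1<b c<b =
  let h , isMaxHook = maxHook-on-block s>0 d>0 gcd≡1 1<b
  in h , isMaxHook (m≤m+n (b * d) c) bd+c<b[d+1] , isMaxHook ≤-refl (≤-<-trans (m≤m+n (b * d) c) bd+c<b[d+1])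
  where
  bd+c<b[d+1] : b * d + c < b * suc d
  bd+c<b[d+1] = begin-strict
    b * d + c  <⟨ +-monoʳ-< (b * d) c<b ⟩
    b * d + b  ≡⟨ +-comm (b * d) b ⟩
    b + b * d  ≡⟨ sym (*-suc b d) ⟩
    b * suc d  ∎
    where open ≤-Reasoning
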